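{- Let $S$ be a finite totally ordered set, $R$ a commutative ring with $1$, $q\in R$, $A=R\langle t_s\mid s\in S\rangle$. Let $J,L\subseteq S$ with $n:=\#J\ge 2$, $J\setminus\{j_1,j_n\}=L\setminus\{l_1\}$ and $j_1<l_1$. Then in $A$ $$t^-_J-t^-_Lt_{j_n}-\sum_{i=2}^{n-1}(-1)^i\,t^-_{(J\cup L)\setminus\{j_i\}}+(-1)^n t_{j_1}t^-_L=0.$$
   Context: Subsets are enumerated increasingly, $J=\{j_1<\dots<j_n\}$, $L=\{l_1<\dots\}$. For $M=\{m_1<\dots<m_{\#M}\}$, $t_M=t_{m_1}\cdots t_{m_{\#M}}$; for $I=\{m_{\alpha_1}<\dots<m_{\alpha_{\#I}}\}\subseteq M$, $\ell_M(I)=\sum_\nu(\alpha_\nu-\nu)$; $t^-_M=\sum_{I\subseteq M,\ \#I\text{ odd}}(-1)^{\ell_M(I)}(-q)^{(\#I-1)/2}t_{M\setminus I}$. -}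

module Defs where

open import Level using (Level)
open import Data.Nat using (ℕ; zero; suc; _∸_; _/_) renaming (_+_ to _+ℕ_)
open import Data.Bool using (Bool; true; false; if_then_else_)
open import Data.Fin using (Fin)
open import Data.Fin.Subset using (Subset)
open import Data.Vec using (Vec; []; _∷_; toList)
open import Data.List using (List; []; _∷_; _++_; map; length; concatMap; foldr)
open import Data.Product using (_×_; _,_)
import Data.Fin.Properties as FinP
import Data.List.Properties as ListP
open import Relation.Nullary using (yes; no)
open import Relation.Binary.PropositionalEquality using (_≡_)
open import Algebra.Bundles using (CommutativeRing)

elems : ∀ {k} → Subset k → List (Fin k)
elems [] = []
elems (true ∷ p) = Fin.zero ∷ map Fin.suc (elems p)
elems (false ∷ p) = map Fin.suc (elems p)

choices : (m : ℕ) → List (Vec Bool m)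
choices zero = [] ∷ []
choices (suc m) = concatMap (λ v → (true ∷ v) ∷ (false ∷ v) ∷ []) (choices m)

module FreeAlgebra {c ℓ : Level} (Rg : CommutativeRing c ℓ) (k : ℕ) where
  open CommutativeRing Rg hiding (_-_)

  Word : Set
  Word = List (Fin k)

  -- Elements of A = R⟨t_s | s ∈ Fin k⟩ as formal finite R-linear combinations of words.
  A : Set c
  A = List (Carrier × Word)

  0A : A
  0A = []

  _⊕_ : A → A → A
  x ⊕ y = x ++ y

  sc : Carrier → A → A
  sc r x = map (λ { (a , w) → (r * a , w) }) x

  ⊖_ : A → A
  ⊖ x = sc (- 1#) x

  _⊗_ : A → A → A
  x ⊗ y = concatMap (λ { (a , v) → map (λ { (b , w) → (a * b , v ++ w) }) y }) x

  mon : Word → A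
  mon w = (1# , w) ∷ []

  t : Subset k → A
  t M = mon (elems M)

  gen : Fin k → A
  gen s = mon (s ∷ [])

  coeff : Word → A → Carrier
  coeff w [] = 0#
  coeff w ((a , u) ∷ x) with ListP.≡-dec FinP._≟_ u w
  ... | yes _ = a + coeff w x
  ... | no _ = coeff w x

  _≈A_ : A → A → Set ℓ
  x ≈A y = (w : Word) → coeff w x ≈ coeff w y

  pow : Carrier → ℕ → Carrier
  pow r zero = 1#
  pow r (suc n) = r * pow r n

  sign : ℕ → Carrier
  sign n = pow (- 1#) n

  card : ∀ {m} → Vec Bool m → ℕ
  card [] = 0
  card (true ∷ v) = suc (card v)
  card (false ∷ v) = card v

  -- α_1 < α_2 < … : the chosen positions (1-based), starting at position `off + 1`
  positions : ∀ {m} → ℕ → Vec Bool m → List ℕ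
  positions off [] = []
  positions off (true ∷ v) = suc off ∷ positions (suc off) v
  positions off (false ∷ v) = positions (suc off) v

  ellSum : ℕ → List ℕ → ℕ
  ellSum ν [] = 0
  ellSum ν (α ∷ as) = (α ∸ ν) +ℕ ellSum (suc ν) as

  ell : ∀ {m} → Vec Bool m → ℕ
  ell v = ellSum 1 (positions 0 v)

  remove : ∀ {m} → Vec Bool m → List (Fin k) → Word
  remove [] ms = ms
  remove (b ∷ v) [] = []
  remove (true ∷ v) (x ∷ ms) = remove v ms
  remove (false ∷ v) (x ∷ ms) = x ∷ remove v ms

  odd : ℕ → Bool
  odd zero = false
  odd (suc n) = if odd n then false else true

  -- t^-_M = Σ_{I ⊆ M, #I odd} (-1)^{ℓ_M(I)} (-q)^{(#I-1)/2} t_{M∖I}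
  tminus : Carrier → Subset k → A
  tminus q M = concatMap term (choices (length ms))
    where
      ms = elems M
      term : Vec Bool (length ms) → A
      term I = if odd (card I)
               then sc (sign (ell I) * pow (- q) ((card I ∸ 1) / 2)) (mon (remove I ms))
               else 0A

  midSum : Carrier → Subset k → ℕ → List (Fin k) → A
  midSum q U i [] = 0A
  midSum q U i (j ∷ js) = sc (sign i) (tminus q (U Data.Fin.Subset.- j)) ⊕ midSum q U (suc i) js

module Submission where

-- Lemma 3.3.  Write O(M) = t⁻_M for a word M = m₁ ⋯ mᵣ (T⁻ below), and E(M)
-- (T⁺ below) for the analogous sum over subsets I of even size, with weight
-- (-1)^ℓ_M(I) (-q)^(#I/2).  Splitting on whether m₁ ∈ I gives the first-letter
-- recursions
--   O(xM) = E(M) − x·O(M),   E(xM) = x·E(M) − q·O(M),   O() = 0, E() = 1,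
-- and by induction the last-letter recursions, with σ = (-1)^#M,
--   O(My) = O(M)·y + σ·E(M),   E(My) = E(M)·y + qσ·O(M).
-- For the alternating deletion sum alt f M = Σᵢ (-1)^(i-1) f(M ∖ mᵢ) they give
-- alt E = O and alt O = 0, hence alt (N ↦ E(Ny)) M = O(M)·y and
-- alt (N ↦ O(Ny)) M = −σ·O(M).  With J = j₁ m jₙ, L = l₁ m and
-- (J ∪ L) ∖ {jᵢ} = j₁ l₁ (m ∖ jᵢ) jₙ (bookkeeping on sorted enumerations), every
-- term of the lemma becomes an R-linear combination of E(m)·jₙ, O(m), j₁·O(m)·jₙ,
-- j₁·E(m), l₁·O(m)·jₙ and j₁·l₁·O(m), and the lemma is a ring identity between
-- their coefficients.

open import Defs
open import Level using (Level)
open import Algebra.Bundles using (CommutativeRing)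
open import Data.Nat using (ℕ)

-- The canonical map ℤ → R into any commutative ring is a ring
-- homomorphism, so the ring solver can be run over R with integer
-- coefficients (signs such as (-1)·(-1) = 1 then normalise by computation).
module IntegerSolver {c ℓ : Level} (Rg : CommutativeRing c ℓ) where
  import Algebra.Solver.Ring.AlmostCommutativeRing as ACR
  open import Data.Nat as ℕ using (ℕ; zero; suc)
  open import Data.Integer as ℤ using (ℤ; +_; -[1+_]; _⊖_)
  import Data.Integer.Properties as ℤP
  import Data.Nat.Properties as ℕP
  open import Data.Maybe using (Maybe; just; nothing)
  open import Relation.Nullary using (yes; no)
  import Relation.Binary.PropositionalEquality as P

  open CommutativeRing Rg
  open import Algebra.Properties.Ring ring
  open import Algebra.Properties.AbelianGroup +-abelianGroup using (⁻¹-∙-comm)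
  open import Relation.Binary.Reasoning.Setoid setoid

  -- n ↦ 1# + ⋯ + 1#, arranged so that 1 ↦ 1# holds definitionally.
  fromℕ : ℕ → Carrier
  fromℕ zero = 0#
  fromℕ (suc zero) = 1#
  fromℕ (suc (suc n)) = 1# + fromℕ (suc n)

  fromℕ-suc : ∀ n → fromℕ (suc n) ≈ 1# + fromℕ n
  fromℕ-suc zero = sym (+-identityʳ 1#)
  fromℕ-suc (suc n) = refl

  fromℕ-+ : ∀ m n → fromℕ (m ℕ.+ n) ≈ fromℕ m + fromℕ n
  fromℕ-+ zero n = sym (+-identityˡ _)
  fromℕ-+ (suc m) n = begin
    fromℕ (suc (m ℕ.+ n))        ≈⟨ fromℕ-suc (m ℕ.+ n) ⟩
    1# + fromℕ (m ℕ.+ n)         ≈⟨ +-congˡ (fromℕ-+ m n) ⟩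
    1# + (fromℕ m + fromℕ n)     ≈⟨ sym (+-assoc _ _ _) ⟩
    (1# + fromℕ m) + fromℕ n     ≈⟨ +-congʳ (sym (fromℕ-suc m)) ⟩
    fromℕ (suc m) + fromℕ n      ∎

  fromℕ-* : ∀ m n → fromℕ (m ℕ.* n) ≈ fromℕ m * fromℕ n
  fromℕ-* zero n = sym (zeroˡ _)
  fromℕ-* (suc m) n = begin
    fromℕ (n ℕ.+ m ℕ.* n)              ≈⟨ fromℕ-+ n (m ℕ.* n) ⟩
    fromℕ n + fromℕ (m ℕ.* n)          ≈⟨ +-cong (sym (*-identityˡ _)) (fromℕ-* m n) ⟩
    1# * fromℕ n + fromℕ m * fromℕ n   ≈⟨ sym (distribʳ _ _ _) ⟩
    (1# + fromℕ m) * fromℕ n           ≈⟨ *-congʳ (sym (fromℕ-suc m)) ⟩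
    fromℕ (suc m) * fromℕ n            ∎

  fromℤ : ℤ → Carrier
  fromℤ (+ n) = fromℕ n
  fromℤ -[1+ n ] = - fromℕ (suc n)

  fromℤ-neg : ∀ i → fromℤ (ℤ.- i) ≈ - fromℤ i
  fromℤ-neg (+ zero) = sym -0#≈0#
  fromℤ-neg (+ suc n) = refl
  fromℤ-neg -[1+ n ] = sym (-‿involutive _)

  fromℤ-⊖ : ∀ m n → fromℤ (m ⊖ n) ≈ fromℕ m - fromℕ n
  fromℤ-⊖ m zero = sym (trans (+-congˡ -0#≈0#) (+-identityʳ _))
  fromℤ-⊖ zero (suc n) = sym (+-identityˡ _)
  fromℤ-⊖ (suc m) (suc n) = begin
    fromℤ (suc m ⊖ suc n)                  ≡⟨ P.cong fromℤ (ℤP.[1+m]⊖[1+n]≡m⊖n m n) ⟩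
    fromℤ (m ⊖ n)                          ≈⟨ fromℤ-⊖ m n ⟩
    fromℕ m - fromℕ n                      ≈⟨ +-congʳ (sym cancel) ⟩
    (1# + fromℕ m - 1#) - fromℕ n          ≈⟨ trans (+-assoc _ _ _) (+-congˡ (-‿+-comm 1# (fromℕ n))) ⟩
    (1# + fromℕ m) - (1# + fromℕ n)        ≈⟨ sym (+-cong (fromℕ-suc m) (-‿cong (fromℕ-suc n))) ⟩
    fromℕ (suc m) - fromℕ (suc n)          ∎
    where
    cancel : 1# + fromℕ m - 1# ≈ fromℕ m
    cancel = trans (+-congʳ (+-comm 1# (fromℕ m)))
             (trans (+-assoc _ _ _) (trans (+-congˡ (-‿inverseʳ 1#)) (+-identityʳ _)))

  fromℤ-+ : ∀ i j → fromℤ (i ℤ.+ j) ≈ fromℤ i + fromℤ j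
  fromℤ-+ (+ m) (+ n) = fromℕ-+ m n
  fromℤ-+ (+ m) -[1+ n ] = fromℤ-⊖ m (suc n)
  fromℤ-+ -[1+ m ] (+ n) = trans (fromℤ-⊖ n (suc m)) (+-comm _ _)
  fromℤ-+ -[1+ m ] -[1+ n ] = begin
    - fromℕ (suc (suc (m ℕ.+ n)))          ≡⟨ P.cong (λ x → - fromℕ (suc x)) (P.sym (ℕP.+-suc m n)) ⟩
    - fromℕ (suc m ℕ.+ suc n)              ≈⟨ -‿cong (fromℕ-+ (suc m) (suc n)) ⟩
    - (fromℕ (suc m) + fromℕ (suc n))      ≈⟨ sym (⁻¹-∙-comm _ _) ⟩
    - fromℕ (suc m) - fromℕ (suc n)        ∎

  fromℤ-pos-* : ∀ m n → fromℤ (+ m ℤ.* + n) ≈ fromℕ m * fromℕ n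
  fromℤ-pos-* m n = trans (reflexive (P.cong fromℤ (P.sym (ℤP.pos-* m n)))) (fromℕ-* m n)

  fromℤ-* : ∀ i j → fromℤ (i ℤ.* j) ≈ fromℤ i * fromℤ j
  fromℤ-* (+ m) (+ n) = fromℤ-pos-* m n
  fromℤ-* (+ m) -[1+ n ] = begin
    fromℤ (+ m ℤ.* ℤ.- (+ suc n))      ≡⟨ P.cong fromℤ (P.sym (ℤP.neg-distribʳ-* (+ m) (+ suc n))) ⟩
    fromℤ (ℤ.- (+ m ℤ.* + suc n))      ≈⟨ fromℤ-neg (+ m ℤ.* + suc n) ⟩
    - fromℤ (+ m ℤ.* + suc n)          ≈⟨ -‿cong (fromℤ-pos-* m (suc n)) ⟩
    - (fromℕ m * fromℕ (suc n))        ≈⟨ -‿distribʳ-* _ _ ⟩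
    fromℕ m * - fromℕ (suc n)          ∎
  fromℤ-* -[1+ m ] (+ n) = begin
    fromℤ (ℤ.- (+ suc m) ℤ.* + n)      ≡⟨ P.cong fromℤ (P.sym (ℤP.neg-distribˡ-* (+ suc m) (+ n))) ⟩
    fromℤ (ℤ.- (+ suc m ℤ.* + n))      ≈⟨ fromℤ-neg (+ suc m ℤ.* + n) ⟩
    - fromℤ (+ suc m ℤ.* + n)          ≈⟨ -‿cong (fromℤ-pos-* (suc m) n) ⟩
    - (fromℕ (suc m) * fromℕ n)        ≈⟨ -‿distribˡ-* _ _ ⟩
    - fromℕ (suc m) * fromℕ n          ∎
  fromℤ-* -[1+ m ] -[1+ n ] = begin
    fromℤ (+ suc m ℤ.* + suc n)            ≈⟨ fromℤ-pos-* (suc m) (suc n) ⟩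
    fromℕ (suc m) * fromℕ (suc n)          ≈⟨ sym (-‿involutive _) ⟩
    - - (fromℕ (suc m) * fromℕ (suc n))    ≈⟨ -‿cong (-‿distribʳ-* _ _) ⟩
    - (fromℕ (suc m) * - fromℕ (suc n))    ≈⟨ -‿distribˡ-* _ _ ⟩
    - fromℕ (suc m) * - fromℕ (suc n)      ∎

  fromℤ-homomorphism : ℤ.+-*-rawRing ACR.-Raw-AlmostCommutative⟶ ACR.fromCommutativeRing Rg
  fromℤ-homomorphism = record
    { ⟦_⟧ = fromℤ ; +-homo = fromℤ-+ ; *-homo = fromℤ-* ; -‿homo = fromℤ-neg
    ; 0-homo = refl ; 1-homo = refl }

  fromℤ-≟ : ∀ i j → Maybe (fromℤ i ≈ fromℤ j)
  fromℤ-≟ i j with i ℤ.≟ j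
  ... | yes P.refl = just refl
  ... | no _ = nothing

  open import Algebra.Solver.Ring ℤ.+-*-rawRing (ACR.fromCommutativeRing Rg) fromℤ-homomorphism fromℤ-≟ public

  :0 :1 : ∀ {n} → Polynomial n
  :0 = con (+ 0)
  :1 = con (+ 1)

-- Bookkeeping on the increasing enumeration `elems` of a subset of Fin k:
-- a strictly increasing list is determined by its members, which makes it
-- possible to compute `elems` of differences and unions.
module SortedSubsets where
  import Data.Nat as ℕ
  open import Data.Fin using (Fin; zero; suc; _<_)
  import Data.Fin.Properties as FinP
  open import Data.Fin.Subset using (Subset; _-_; _∪_; _─_; ⊥)
  open import Data.Vec using ([]; _∷_; lookup)
  import Data.Vec.Properties as VecP
  open import Data.List using (List; []; _∷_; _++_; map)
  import Data.List.Properties as ListP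
  open import Data.List.Relation.Unary.All as All using (All; []; _∷_)
  import Data.List.Relation.Unary.All.Properties as AllP
  open import Data.List.Relation.Unary.AllPairs as AllPairs using (AllPairs; []; _∷_)
  import Data.List.Relation.Unary.AllPairs.Properties as AllPairsP
  open import Data.Bool using (Bool; true; false; _∨_; _∧_; not)
  open import Data.Bool.Properties using (∨-assoc; ∨-idempotentCommutativeMonoid)
  import Algebra.Solver.IdempotentCommutativeMonoid as ∨-Solver
  open import Relation.Nullary using (¬_; does; yes; no)
  open import Relation.Nullary.Decidable using (dec-true; dec-false)
  open import Relation.Binary.Definitions using (tri<; tri≈; tri>)
  open import Relation.Binary.PropositionalEquality as P using (_≡_; refl)

  private variable k : ℕ

  Increasing : List (Fin k) → Set
  Increasing = AllPairs _<_

  _∈ᵇ_ : Fin k → List (Fin k) → Bool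
  z ∈ᵇ [] = false
  z ∈ᵇ (u ∷ us) = does (z FinP.≟ u) ∨ z ∈ᵇ us

  ∈ᵇ-++ : ∀ (z : Fin k) xs ys → z ∈ᵇ (xs ++ ys) ≡ z ∈ᵇ xs ∨ z ∈ᵇ ys
  ∈ᵇ-++ z [] ys = refl
  ∈ᵇ-++ z (u ∷ xs) ys =
    P.trans (P.cong (does (z FinP.≟ u) ∨_) (∈ᵇ-++ z xs ys)) (P.sym (∨-assoc (does (z FinP.≟ u)) _ _))

  ∉-above : ∀ {z : Fin k} {ys} → All (z <_) ys → z ∈ᵇ ys ≡ false
  ∉-above [] = refl
  ∉-above (z<y ∷ a) = P.cong₂ _∨_ (dec-false (_ FinP.≟ _) (FinP.<⇒≢ z<y)) (∉-above a)

  ∈ᵇ-head : ∀ (x : Fin k) xs → x ∈ᵇ (x ∷ xs) ≡ true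
  ∈ᵇ-head x xs = P.cong (_∨ x ∈ᵇ xs) (dec-true (x FinP.≟ x) refl)

  increasing-ext : ∀ {xs ys : List (Fin k)} → Increasing xs → Increasing ys →
    (∀ z → z ∈ᵇ xs ≡ z ∈ᵇ ys) → xs ≡ ys
  increasing-ext [] [] same = refl
  increasing-ext {ys = y ∷ ys} [] (_ ∷ _) same with () ← P.trans (same y) (∈ᵇ-head y ys)
  increasing-ext {xs = x ∷ xs} (_ ∷ _) [] same with () ← P.trans (P.sym (same x)) (∈ᵇ-head x xs)
  increasing-ext {xs = x ∷ xs} {ys = y ∷ ys} (x<xs ∷ incx) (y<ys ∷ incy) same with FinP.<-cmp x y
  ... | tri< x<y _ _ with () ← P.trans (P.sym (∈ᵇ-head x xs))
        (P.trans (same x) (∉-above {ys = y ∷ ys} (x<y ∷ All.map (FinP.<-trans x<y) y<ys)))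
  ... | tri> _ _ y<x with () ← P.trans (P.sym (∈ᵇ-head y ys))
        (P.trans (P.sym (same y)) (∉-above {ys = x ∷ xs} (y<x ∷ All.map (FinP.<-trans y<x) x<xs)))
  ... | tri≈ _ refl _ = P.cong (x ∷_) (increasing-ext incx incy same-tail)
    where
    same-tail : ∀ z → z ∈ᵇ xs ≡ z ∈ᵇ ys
    same-tail z with z FinP.≟ x | same z
    ... | yes refl | _ = P.trans (∉-above x<xs) (P.sym (∉-above y<ys))
    ... | no _ | e = e

  increasing-delete : ∀ xs {y : Fin k} {ys} → Increasing (xs ++ y ∷ ys) → Increasing (xs ++ ys)
  increasing-delete [] (_ ∷ inc) = inc
  increasing-delete (x ∷ xs) (x<rest ∷ inc) =
    AllP.++⁺ (AllP.++⁻ˡ xs x<rest) (All.tail (AllP.++⁻ʳ xs x<rest)) ∷ increasing-delete xs inc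

  ∉-delete : ∀ xs {y : Fin k} {ys} → Increasing (xs ++ y ∷ ys) → y ∈ᵇ (xs ++ ys) ≡ false
  ∉-delete [] {y} (y<ys ∷ _) = ∉-above {z = y} y<ys
  ∉-delete (x ∷ xs) (x<rest ∷ inc) =
    P.cong₂ _∨_ (dec-false (_ FinP.≟ _) (λ e → FinP.<⇒≢ x<y (P.sym e))) (∉-delete xs inc)
    where x<y = All.head (AllP.++⁻ʳ xs x<rest)

  ∈ᵇ-delete : ∀ xs {y z : Fin k} {ys} → ¬ z ≡ y → z ∈ᵇ (xs ++ y ∷ ys) ≡ z ∈ᵇ (xs ++ ys)
  ∈ᵇ-delete [] z≢y = P.cong (_∨ _) (dec-false (_ FinP.≟ _) z≢y)
  ∈ᵇ-delete (x ∷ xs) {z = z} z≢y = P.cong (does (z FinP.≟ x) ∨_) (∈ᵇ-delete xs z≢y)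

  ∈ᵇ-map-suc : ∀ (z : Fin k) xs → suc z ∈ᵇ map suc xs ≡ z ∈ᵇ xs
  ∈ᵇ-map-suc z [] = refl
  ∈ᵇ-map-suc z (x ∷ xs) = P.cong (does (z FinP.≟ x) ∨_) (∈ᵇ-map-suc z xs)

  zero-∉-map-suc : (xs : List (Fin k)) → zero ∈ᵇ map suc xs ≡ false
  zero-∉-map-suc [] = refl
  zero-∉-map-suc (x ∷ xs) = zero-∉-map-suc xs

  elems-increasing : (S : Subset k) → Increasing (elems S)
  elems-increasing [] = []
  elems-increasing (true ∷ S) =
    AllP.map⁺ (All.universal (λ _ → ℕ.z<s) _) ∷ AllPairsP.map⁺ (AllPairs.map ℕ.s<s (elems-increasing S))
  elems-increasing (false ∷ S) = AllPairsP.map⁺ (AllPairs.map ℕ.s<s (elems-increasing S))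

  elems-∈ᵇ : (S : Subset k) (z : Fin k) → z ∈ᵇ elems S ≡ lookup S z
  elems-∈ᵇ (true ∷ S) zero = refl
  elems-∈ᵇ (false ∷ S) zero = zero-∉-map-suc (elems S)
  elems-∈ᵇ (true ∷ S) (suc z) = P.trans (∈ᵇ-map-suc z (elems S)) (elems-∈ᵇ S z)
  elems-∈ᵇ (false ∷ S) (suc z) = P.trans (∈ᵇ-map-suc z (elems S)) (elems-∈ᵇ S z)

  elems-char : (S : Subset k) {ys : List (Fin k)} → Increasing ys →
    (∀ z → lookup S z ≡ z ∈ᵇ ys) → elems S ≡ ys
  elems-char S inc members =
    increasing-ext (elems-increasing S) inc (λ z → P.trans (elems-∈ᵇ S z) (members z))

  lookup-─⊥ : (S : Subset k) (z : Fin k) → lookup (S ─ ⊥) z ≡ lookup S z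
  lookup-─⊥ (b ∷ S) zero = refl
  lookup-─⊥ (b ∷ S) (suc z) = lookup-─⊥ S z

  lookup-minus : (S : Subset k) (y z : Fin k) → lookup (S - y) z ≡ not (does (z FinP.≟ y)) ∧ lookup S z
  lookup-minus (b ∷ S) zero zero = refl
  lookup-minus (b ∷ S) zero (suc z) = lookup-─⊥ S z
  lookup-minus (b ∷ S) (suc y) zero = refl
  lookup-minus (b ∷ S) (suc y) (suc z) = lookup-minus S y z

  elems-minus : (S : Subset k) (xs : List (Fin k)) (y : Fin k) (ys : List (Fin k)) →
    elems S ≡ xs ++ y ∷ ys → elems (S - y) ≡ xs ++ ys
  elems-minus S xs y ys e = elems-char (S - y) (increasing-delete xs inc) members
    where
    open P.≡-Reasoning
    inc : Increasing (xs ++ y ∷ ys)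
    inc = P.subst Increasing e (elems-increasing S)

    removal : ∀ z → not (does (z FinP.≟ y)) ∧ z ∈ᵇ (xs ++ y ∷ ys) ≡ z ∈ᵇ (xs ++ ys)
    removal z with z FinP.≟ y
    ... | yes refl = P.sym (∉-delete xs inc)
    ... | no z≢y = ∈ᵇ-delete xs z≢y

    members : ∀ z → lookup (S - y) z ≡ z ∈ᵇ (xs ++ ys)
    members z = begin
      lookup (S - y) z                           ≡⟨ lookup-minus S y z ⟩
      not (does (z FinP.≟ y)) ∧ lookup S z        ≡⟨ P.cong (_ ∧_) (P.trans (P.sym (elems-∈ᵇ S z)) (P.cong (z ∈ᵇ_) e)) ⟩
      not (does (z FinP.≟ y)) ∧ z ∈ᵇ (xs ++ y ∷ ys) ≡⟨ removal z ⟩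
      z ∈ᵇ (xs ++ ys)                            ∎

  ∨-shuffle : ∀ a b m y → (a ∨ (m ∨ y)) ∨ (b ∨ m) ≡ a ∨ (b ∨ (m ∨ y))
  ∨-shuffle = solve 4 (λ a b m y → (a ⊕ (m ⊕ y)) ⊕ (b ⊕ m) ⊜ a ⊕ (b ⊕ (m ⊕ y))) refl
    where open ∨-Solver ∨-idempotentCommutativeMonoid

  elems-∪ : (J L : Subset k) (a b c : Fin k) (m : List (Fin k)) →
    elems J ≡ a ∷ (m ++ c ∷ []) → elems L ≡ b ∷ m → a < b → b < c →
    elems (J ∪ L) ≡ a ∷ b ∷ (m ++ c ∷ [])
  elems-∪ J L a b c m eJ eL a<b b<c = elems-char (J ∪ L) incU members
    where
    open P.≡-Reasoning
    incJ : Increasing (a ∷ (m ++ c ∷ []))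
    incJ = P.subst Increasing eJ (elems-increasing J)
    incL : Increasing (b ∷ m)
    incL = P.subst Increasing eL (elems-increasing L)
    incU : Increasing (a ∷ b ∷ (m ++ c ∷ []))
    incU = (a<b ∷ AllPairs.head incJ) ∷ AllP.∷ʳ⁺ (AllPairs.head incL) b<c ∷ AllPairs.tail incJ

    members : ∀ z → lookup (J ∪ L) z ≡ z ∈ᵇ (a ∷ b ∷ (m ++ c ∷ []))
    members z = begin
      lookup (J ∪ L) z                              ≡⟨ VecP.lookup-zipWith _∨_ z J L ⟩
      lookup J z ∨ lookup L z                        ≡⟨ P.cong₂ _∨_ (P.trans (P.sym (elems-∈ᵇ J z)) (P.cong (z ∈ᵇ_) eJ))
                                                                   (P.trans (P.sym (elems-∈ᵇ L z)) (P.cong (z ∈ᵇ_) eL)) ⟩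
      z ∈ᵇ (a ∷ (m ++ c ∷ [])) ∨ z ∈ᵇ (b ∷ m)        ≡⟨ P.cong (λ x → (does (z FinP.≟ a) ∨ x) ∨ z ∈ᵇ (b ∷ m)) (∈ᵇ-++ z m (c ∷ [])) ⟩
      (does (z FinP.≟ a) ∨ (z ∈ᵇ m ∨ z ∈ᵇ (c ∷ []))) ∨ z ∈ᵇ (b ∷ m)
                                                     ≡⟨ ∨-shuffle (does (z FinP.≟ a)) (does (z FinP.≟ b)) (z ∈ᵇ m) (z ∈ᵇ (c ∷ [])) ⟩
      does (z FinP.≟ a) ∨ (does (z FinP.≟ b) ∨ (z ∈ᵇ m ∨ z ∈ᵇ (c ∷ [])))
                                                     ≡⟨ P.cong (λ x → does (z FinP.≟ a) ∨ (does (z FinP.≟ b) ∨ x)) (P.sym (∈ᵇ-++ z m (c ∷ []))) ⟩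
      z ∈ᵇ (a ∷ b ∷ (m ++ c ∷ []))                  ∎

  increasing-after : ∀ xs {y : Fin k} {ys} → Increasing (xs ++ y ∷ ys) → All (y <_) ys
  increasing-after [] (y<ys ∷ _) = y<ys
  increasing-after (x ∷ xs) (_ ∷ inc) = increasing-after xs inc

  shared-middle : (J L : Subset k) (a b c : Fin k) (m ls : List (Fin k)) →
    elems J ≡ a ∷ (m ++ c ∷ []) → elems L ≡ b ∷ ls → (J - a) - c ≡ L - b → ls ≡ m
  shared-middle J L a b c m ls eJ eL eS = begin
    ls                    ≡⟨ P.sym (elems-minus L [] b ls eL) ⟩
    elems (L - b)         ≡⟨ P.cong elems (P.sym eS) ⟩
    elems ((J - a) - c)   ≡⟨ elems-minus (J - a) m c [] (elems-minus J [] a (m ++ c ∷ []) eJ) ⟩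
    m ++ []               ≡⟨ ListP.++-identityʳ m ⟩
    m                     ∎
    where open P.≡-Reasoning

  delete-middle : (J L : Subset k) (a b c : Fin k) (m : List (Fin k)) →
    elems J ≡ a ∷ (m ++ c ∷ []) → elems L ≡ b ∷ m → a < b →
    ∀ pre j post → m ≡ pre ++ j ∷ post → elems ((J ∪ L) - j) ≡ a ∷ b ∷ ((pre ++ post) ++ c ∷ [])
  delete-middle J L a b c m eJ eL a<b pre j post refl = begin
    elems ((J ∪ L) - j)                 ≡⟨ elems-minus (J ∪ L) (a ∷ b ∷ pre) j (post ++ c ∷ []) enumeration ⟩
    a ∷ b ∷ (pre ++ post ++ c ∷ [])     ≡⟨ P.cong (λ x → a ∷ b ∷ x) (P.sym (ListP.++-assoc pre post (c ∷ []))) ⟩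
    a ∷ b ∷ ((pre ++ post) ++ c ∷ [])   ∎
    where
    open P.≡-Reasoning

    incJ : Increasing (pre ++ j ∷ (post ++ c ∷ []))
    incJ = P.subst Increasing (ListP.++-assoc pre (j ∷ post) (c ∷ []))
                   (AllPairs.tail (P.subst Increasing eJ (elems-increasing J)))

    b<j : b < j
    b<j = All.head (AllP.++⁻ʳ pre (AllPairs.head (P.subst Increasing eL (elems-increasing L))))

    j<c : j < c
    j<c = All.head (AllP.++⁻ʳ post (increasing-after pre incJ))

    enumeration : elems (J ∪ L) ≡ (a ∷ b ∷ pre) ++ j ∷ (post ++ c ∷ [])
    enumeration = P.trans (elems-∪ J L a b c m eJ eL a<b (FinP.<-trans b<j j<c))
                          (P.cong (λ x → a ∷ b ∷ x) (ListP.++-assoc pre (j ∷ post) (c ∷ [])))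

module CoefficientAlgebra {c ℓ : Level} (Rg : CommutativeRing c ℓ) (k : ℕ) where
  open import Level using (_⊔_)
  open import Data.Nat using (suc)
  open import Data.Fin using (Fin)
  import Data.Fin.Properties as FinP
  open import Data.List using (List; []; _∷_; _++_; _∷ʳ_; map; length; initLast; _∷ʳ′_)
  import Data.List.Properties as ListP
  open import Data.Product using (_,_; ∃)
  open import Data.Sum using (_⊎_; inj₁; inj₂)
  open import Data.Empty using (⊥-elim)
  open import Relation.Nullary using (¬_; yes; no)
  open import Relation.Binary.Bundles using (Setoid)
  open import Relation.Binary.PropositionalEquality as P using (_≡_)
  import Relation.Binary.Reasoning.Setoid

  open CommutativeRing Rg hiding (_-_)
  open FreeAlgebra Rg k
  open IntegerSolver Rg using (solve; _:=_; _:+_; _:*_; :-_; :1)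
  open import Relation.Binary.Reasoning.Setoid setoid

  -- Coefficientwise equality _≈A_, packed in a record so that both sides
  -- can be inferred from a proof.
  record _≋_ (x y : A) : Set ℓ where
    constructor coefficientwise
    field coeff-≈ : x ≈A y
  open _≋_ public

  infix 4 _≋_

  ≋-setoid : Setoid c ℓ
  ≋-setoid = record
    { Carrier = A ; _≈_ = _≋_
    ; isEquivalence = record
      { refl = coefficientwise (λ w → refl)
      ; sym = λ (coefficientwise p) → coefficientwise (λ w → sym (p w))
      ; trans = λ (coefficientwise p) (coefficientwise p′) → coefficientwise (λ w → trans (p w) (p′ w)) } }

  open Setoid ≋-setoid public using () renaming (refl to ≋-refl; sym to ≋-sym; trans to ≋-trans; reflexive to ≡⇒≋)

  module ≋-Reasoning = Relation.Binary.Reasoning.Setoid ≋-setoid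

  coeff-++ : ∀ w x y → coeff w (x ⊕ y) ≈ coeff w x + coeff w y
  coeff-++ w [] y = sym (+-identityˡ _)
  coeff-++ w ((a , u) ∷ x) y with ListP.≡-dec FinP._≟_ u w
  ... | yes _ = trans (+-congˡ (coeff-++ w x y)) (sym (+-assoc _ _ _))
  ... | no _ = coeff-++ w x y

  coeff-sc : ∀ w r x → coeff w (sc r x) ≈ r * coeff w x
  coeff-sc w r [] = sym (zeroʳ r)
  coeff-sc w r ((a , u) ∷ x) with ListP.≡-dec FinP._≟_ u w
  ... | yes _ = trans (+-congˡ (coeff-sc w r x)) (sym (distribˡ r a _))
  ... | no _ = coeff-sc w r x

  ⊕-cong : ∀ {x x′ y y′} → x ≋ x′ → y ≋ y′ → x ⊕ y ≋ x′ ⊕ y′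
  ⊕-cong {x} {x′} {y} {y′} (coefficientwise p) (coefficientwise p′) = coefficientwise λ w → begin
    coeff w (x ⊕ y)             ≈⟨ coeff-++ w x y ⟩
    coeff w x + coeff w y       ≈⟨ +-cong (p w) (p′ w) ⟩
    coeff w x′ + coeff w y′     ≈⟨ coeff-++ w x′ y′ ⟨
    coeff w (x′ ⊕ y′)           ∎

  sc-cong : ∀ {r r′ x x′} → r ≈ r′ → x ≋ x′ → sc r x ≋ sc r′ x′
  sc-cong {r} {r′} {x} {x′} r≈r′ (coefficientwise p) = coefficientwise λ w → begin
    coeff w (sc r x)     ≈⟨ coeff-sc w r x ⟩
    r * coeff w x        ≈⟨ *-cong r≈r′ (p w) ⟩
    r′ * coeff w x′      ≈⟨ coeff-sc w r′ x′ ⟨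
    coeff w (sc r′ x′)   ∎

  ⊖-cong : ∀ {x x′} → x ≋ x′ → ⊖ x ≋ ⊖ x′
  ⊖-cong = sc-cong refl

  mapW : (Word → Word) → A → A
  mapW h = map (λ (a , u) → (a , h u))

  mapW-cong : (h : Word → Word) → (∀ {u v} → h u ≡ h v → u ≡ v) →
    (∀ w → (∃ λ u → h u ≡ w) ⊎ (∀ u → ¬ h u ≡ w)) →
    ∀ {x y} → x ≋ y → mapW h x ≋ mapW h y
  mapW-cong h injective image {x} {y} (coefficientwise p) = coefficientwise λ w → by-image w (image w)
    where
    -- coefficients of words h u come from u, all other coefficients vanish
    in-image : ∀ u z → coeff (h u) (mapW h z) ≈ coeff u z
    in-image u [] = refl
    in-image u ((a , v) ∷ z) with ListP.≡-dec FinP._≟_ (h v) (h u) | ListP.≡-dec FinP._≟_ v u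
    ... | yes _ | yes _ = +-congˡ (in-image u z)
    ... | no _ | no _ = in-image u z
    ... | yes e | no ne = ⊥-elim (ne (injective e))
    ... | no ne | yes e = ⊥-elim (ne (P.cong h e))

    outside : ∀ w → (∀ u → ¬ h u ≡ w) → ∀ z → coeff w (mapW h z) ≈ 0#
    outside w out [] = refl
    outside w out ((a , u) ∷ z) with ListP.≡-dec FinP._≟_ (h u) w
    ... | yes e = ⊥-elim (out u e)
    ... | no _ = outside w out z

    by-image : ∀ w → (∃ λ u → h u ≡ w) ⊎ (∀ u → ¬ h u ≡ w) → coeff w (mapW h x) ≈ coeff w (mapW h y)
    by-image .(h u) (inj₁ (u , P.refl)) = trans (in-image u x) (trans (p u) (sym (in-image u y)))
    by-image w (inj₂ out) = trans (outside w out x) (sym (outside w out y))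

  lmul : Fin k → A → A
  lmul x = mapW (x ∷_)

  rmul : Fin k → A → A
  rmul y = mapW (_∷ʳ y)

  lmul-cong : ∀ x {u v} → u ≋ v → lmul x u ≋ lmul x v
  lmul-cong x = mapW-cong (x ∷_) ListP.∷-injectiveʳ image
    where
    image : ∀ w → (∃ λ u → x ∷ u ≡ w) ⊎ (∀ u → ¬ x ∷ u ≡ w)
    image [] = inj₂ λ u ()
    image (z ∷ w) with z FinP.≟ x
    ... | yes P.refl = inj₁ (w , P.refl)
    ... | no z≢x = inj₂ λ u e → z≢x (P.sym (ListP.∷-injectiveˡ e))

  rmul-cong : ∀ y {u v} → u ≋ v → rmul y u ≋ rmul y v
  rmul-cong y = mapW-cong (_∷ʳ y) (λ {u} {v} → ListP.∷ʳ-injectiveˡ u v) image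
    where
    image : ∀ w → (∃ λ u → u ∷ʳ y ≡ w) ⊎ (∀ u → ¬ u ∷ʳ y ≡ w)
    image w with initLast w
    ... | [] = inj₂ λ { [] () ; (_ ∷ _) () }
    ... | init ∷ʳ′ z with z FinP.≟ y
    ...   | yes P.refl = inj₁ (init , P.refl)
    ...   | no z≢y = inj₂ λ u e → z≢y (P.sym (ListP.∷ʳ-injectiveʳ u init e))

  mapW-sc : ∀ h r u → mapW h (sc r u) ≡ sc r (mapW h u)
  mapW-sc h r [] = P.refl
  mapW-sc h r ((a , v) ∷ u) = P.cong (_ ∷_) (mapW-sc h r u)

  mapW-⊕ : ∀ h u v → mapW h (u ⊕ v) ≡ mapW h u ⊕ mapW h v
  mapW-⊕ h = ListP.map-++ _

  lmul-rmul : ∀ x y u → lmul x (rmul y u) ≡ rmul y (lmul x u)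
  lmul-rmul x y [] = P.refl
  lmul-rmul x y ((a , v) ∷ u) = P.cong (_ ∷_) (lmul-rmul x y u)

  cons-cong : ∀ {r r′ u x y} → r ≈ r′ → x ≋ y → (r , u) ∷ x ≋ (r′ , u) ∷ y
  cons-cong {r} {r′} {u} {x} {y} r≈r′ (coefficientwise p) = coefficientwise head
    where
    head : ∀ w → coeff w ((r , u) ∷ x) ≈ coeff w ((r′ , u) ∷ y)
    head w with ListP.≡-dec FinP._≟_ u w
    ... | yes _ = +-cong r≈r′ (p w)
    ... | no _ = p w

  gen-⊗ : ∀ x u → gen x ⊗ u ≋ lmul x u
  gen-⊗ x u = ≋-trans (≡⇒≋ (ListP.++-identityʳ _)) (unit u)
    where
    unit : ∀ u → map (λ { (b , w) → (1# * b , (x ∷ []) ++ w) }) u ≋ lmul x u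
    unit [] = ≋-refl
    unit ((b , w) ∷ u) = cons-cong (*-identityˡ b) (unit u)

  ⊗-gen : ∀ y u → u ⊗ gen y ≋ rmul y u
  ⊗-gen y [] = ≋-refl
  ⊗-gen y ((b , w) ∷ u) = cons-cong (*-identityʳ b) (⊗-gen y u)

  -- Pushing the
  -- multiplications down to the leaves exhibits the coefficient of any word
  -- as an R-linear combination of coefficients of the leaves, so identities
  -- between linear expressions reduce to ring identities (proved by `solve`).
  infixl 6 _⊞_
  infixr 7 _⊙_

  data LinExpr : Set c where
    ⌜_⌝ : A → LinExpr
    _⊞_ : LinExpr → LinExpr → LinExpr
    _⊙_ : Carrier → LinExpr → LinExpr
    left : Fin k → LinExpr → LinExpr
    right : Fin k → LinExpr → LinExpr

  ⟦_⟧ : LinExpr → A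
  ⟦ ⌜ a ⌝ ⟧ = a
  ⟦ e ⊞ f ⟧ = ⟦ e ⟧ ⊕ ⟦ f ⟧
  ⟦ r ⊙ e ⟧ = sc r ⟦ e ⟧
  ⟦ left x e ⟧ = lmul x ⟦ e ⟧
  ⟦ right y e ⟧ = rmul y ⟦ e ⟧

  -- Multiplication by x₁ ⋯ xₙ on the left, by yₙ ⋯ y₁ on the right.
  lmuls : List (Fin k) → A → A
  lmuls [] a = a
  lmuls (x ∷ xs) a = lmul x (lmuls xs a)

  rmuls : List (Fin k) → A → A
  rmuls [] a = a
  rmuls (y ∷ ys) a = rmul y (rmuls ys a)

  lmuls-snoc : ∀ xs x a → lmuls (xs ++ x ∷ []) a ≡ lmuls xs (lmul x a)
  lmuls-snoc [] x a = P.refl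
  lmuls-snoc (x′ ∷ xs) x a = P.cong (lmul x′) (lmuls-snoc xs x a)

  rmuls-snoc : ∀ ys y a → rmuls (ys ++ y ∷ []) a ≡ rmuls ys (rmul y a)
  rmuls-snoc [] y a = P.refl
  rmuls-snoc (y′ ∷ ys) y a = P.cong (rmul y′) (rmuls-snoc ys y a)

  rmuls-lmul : ∀ ys x a → rmuls ys (lmul x a) ≡ lmul x (rmuls ys a)
  rmuls-lmul [] x a = P.refl
  rmuls-lmul (y ∷ ys) x a = P.trans (P.cong (rmul y) (rmuls-lmul ys x a)) (P.sym (lmul-rmul x y _))

  lmuls-⊕ : ∀ xs u v → lmuls xs (u ⊕ v) ≡ lmuls xs u ⊕ lmuls xs v
  lmuls-⊕ [] u v = P.refl
  lmuls-⊕ (x ∷ xs) u v = P.trans (P.cong (lmul x) (lmuls-⊕ xs u v)) (mapW-⊕ _ (lmuls xs u) (lmuls xs v))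

  rmuls-⊕ : ∀ ys u v → rmuls ys (u ⊕ v) ≡ rmuls ys u ⊕ rmuls ys v
  rmuls-⊕ [] u v = P.refl
  rmuls-⊕ (y ∷ ys) u v = P.trans (P.cong (rmul y) (rmuls-⊕ ys u v)) (mapW-⊕ _ (rmuls ys u) (rmuls ys v))

  lmuls-sc : ∀ xs r u → lmuls xs (sc r u) ≡ sc r (lmuls xs u)
  lmuls-sc [] r u = P.refl
  lmuls-sc (x ∷ xs) r u = P.trans (P.cong (lmul x) (lmuls-sc xs r u)) (mapW-sc _ r _)

  rmuls-sc : ∀ ys r u → rmuls ys (sc r u) ≡ sc r (rmuls ys u)
  rmuls-sc [] r u = P.refl
  rmuls-sc (y ∷ ys) r u = P.trans (P.cong (rmul y) (rmuls-sc ys r u)) (mapW-sc _ r _)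

  push : List (Fin k) → List (Fin k) → LinExpr → LinExpr
  push xs ys ⌜ a ⌝ = ⌜ lmuls xs (rmuls ys a) ⌝
  push xs ys (e ⊞ f) = push xs ys e ⊞ push xs ys f
  push xs ys (r ⊙ e) = r ⊙ push xs ys e
  push xs ys (left x e) = push (xs ++ x ∷ []) ys e
  push xs ys (right y e) = push xs (ys ++ y ∷ []) e

  push-correct : ∀ xs ys e → ⟦ push xs ys e ⟧ ≡ lmuls xs (rmuls ys ⟦ e ⟧)
  push-correct xs ys ⌜ a ⌝ = P.refl
  push-correct xs ys (e ⊞ f) = P.trans (P.cong₂ _⊕_ (push-correct xs ys e) (push-correct xs ys f))
    (P.sym (P.trans (P.cong (lmuls xs) (rmuls-⊕ ys _ _)) (lmuls-⊕ xs _ _)))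
  push-correct xs ys (r ⊙ e) = P.trans (P.cong (sc r) (push-correct xs ys e))
    (P.sym (P.trans (P.cong (lmuls xs) (rmuls-sc ys r _)) (lmuls-sc xs r _)))
  push-correct xs ys (left x e) = P.trans (push-correct (xs ++ x ∷ []) ys e)
    (P.trans (lmuls-snoc xs x _) (P.cong (lmuls xs) (P.sym (rmuls-lmul ys x _))))
  push-correct xs ys (right y e) = P.trans (push-correct xs (ys ++ y ∷ []) e) (P.cong (lmuls xs) (rmuls-snoc ys y _))

  coeffs : Word → LinExpr → Carrier
  coeffs w (e ⊞ f) = coeffs w e + coeffs w f
  coeffs w (r ⊙ e) = r * coeffs w e
  coeffs w e = coeff w ⟦ e ⟧

  coeffs-correct : ∀ w e → coeff w ⟦ e ⟧ ≈ coeffs w e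
  coeffs-correct w ⌜ a ⌝ = refl
  coeffs-correct w (e ⊞ f) = trans (coeff-++ w ⟦ e ⟧ ⟦ f ⟧) (+-cong (coeffs-correct w e) (coeffs-correct w f))
  coeffs-correct w (r ⊙ e) = trans (coeff-sc w r ⟦ e ⟧) (*-congˡ (coeffs-correct w e))
  coeffs-correct w (left x e) = refl
  coeffs-correct w (right y e) = refl

  by-coefficients : ∀ e₁ e₂ → (∀ w → coeffs w (push [] [] e₁) ≈ coeffs w (push [] [] e₂)) → ⟦ e₁ ⟧ ≋ ⟦ e₂ ⟧
  by-coefficients e₁ e₂ p = coefficientwise λ w → begin
    coeff w ⟦ e₁ ⟧                ≡⟨ P.cong (coeff w) (P.sym (push-correct [] [] e₁)) ⟩
    coeff w ⟦ push [] [] e₁ ⟧     ≈⟨ coeffs-correct w (push [] [] e₁) ⟩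
    coeffs w (push [] [] e₁)      ≈⟨ p w ⟩
    coeffs w (push [] [] e₂)      ≈⟨ coeffs-correct w (push [] [] e₂) ⟨
    coeff w ⟦ push [] [] e₂ ⟧     ≡⟨ P.cong (coeff w) (push-correct [] [] e₂) ⟩
    coeff w ⟦ e₂ ⟧                ∎

  record Linear (Φ : A → A) : Set (c ⊔ ℓ) where
    field
      cong : ∀ {x y} → x ≋ y → Φ x ≋ Φ y
      ⊕-hom : ∀ x y → Φ (x ⊕ y) ≋ Φ x ⊕ Φ y
      sc-hom : ∀ r x → Φ (sc r x) ≋ sc r (Φ x)
      0-hom : Φ 0A ≋ 0A

  linear-lmul : ∀ x → Linear (lmul x)
  linear-lmul x = record
    { cong = lmul-cong x ; ⊕-hom = λ u v → ≡⇒≋ (mapW-⊕ _ u v)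
    ; sc-hom = λ r u → ≡⇒≋ (mapW-sc _ r u) ; 0-hom = ≋-refl }

  linear-rmul : ∀ y → Linear (rmul y)
  linear-rmul y = record
    { cong = rmul-cong y ; ⊕-hom = λ u v → ≡⇒≋ (mapW-⊕ _ u v)
    ; sc-hom = λ r u → ≡⇒≋ (mapW-sc _ r u) ; 0-hom = ≋-refl }

  linear-sc : ∀ r → Linear (sc r)
  linear-sc r = record
    { cong = sc-cong refl ; ⊕-hom = λ u v → ≡⇒≋ (ListP.map-++ _ u v)
    ; sc-hom = λ r′ u → by-coefficients (r ⊙ r′ ⊙ ⌜ u ⌝) (r′ ⊙ r ⊙ ⌜ u ⌝)
        (λ w → solve 3 (λ a b x → a :* (b :* x) := b :* (a :* x)) refl r r′ (coeff w u))
    ; 0-hom = ≋-refl }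

  linear-∘ : ∀ {Φ Ψ} → Linear Φ → Linear Ψ → Linear (λ x → Φ (Ψ x))
  linear-∘ lΦ lΨ = record
    { cong = λ p → Φ.cong (Ψ.cong p)
    ; ⊕-hom = λ u v → ≋-trans (Φ.cong (Ψ.⊕-hom u v)) (Φ.⊕-hom _ _)
    ; sc-hom = λ r u → ≋-trans (Φ.cong (Ψ.sc-hom r u)) (Φ.sc-hom r _)
    ; 0-hom = ≋-trans (Φ.cong Ψ.0-hom) Φ.0-hom }
    where module Φ = Linear lΦ
          module Ψ = Linear lΨ

  linear-⊕ : ∀ {Φ Ψ} → Linear Φ → Linear Ψ → Linear (λ x → Φ x ⊕ Ψ x)
  linear-⊕ {Φ} {Ψ} lΦ lΨ = record
    { cong = λ p → ⊕-cong (Φ.cong p) (Ψ.cong p)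
    ; ⊕-hom = λ u v → ≋-trans (⊕-cong (Φ.⊕-hom u v) (Ψ.⊕-hom u v))
        (by-coefficients ((⌜ Φ u ⌝ ⊞ ⌜ Φ v ⌝) ⊞ (⌜ Ψ u ⌝ ⊞ ⌜ Ψ v ⌝)) ((⌜ Φ u ⌝ ⊞ ⌜ Ψ u ⌝) ⊞ (⌜ Φ v ⌝ ⊞ ⌜ Ψ v ⌝))
          (λ w → solve 4 (λ a b x y → (a :+ b) :+ (x :+ y) := (a :+ x) :+ (b :+ y)) refl
                   (coeff w (Φ u)) (coeff w (Φ v)) (coeff w (Ψ u)) (coeff w (Ψ v))))
    ; sc-hom = λ r u → ≋-trans (⊕-cong (Φ.sc-hom r u) (Ψ.sc-hom r u)) (≡⇒≋ (P.sym (ListP.map-++ _ (Φ u) (Ψ u))))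
    ; 0-hom = ⊕-cong Φ.0-hom Ψ.0-hom }
    where module Φ = Linear lΦ
          module Ψ = Linear lΨ

  -- The alternating deletion sum: alt g (m₁ ⋯ mₙ) = Σᵢ (-1)^(i-1) g(m₁ ⋯ m̂ᵢ ⋯ mₙ).
  alt : (Word → A) → Word → A
  alt g [] = 0A
  alt g (x ∷ M) = g M ⊕ (⊖ alt (λ N → g (x ∷ N)) M)

  alt-cong : ∀ {f g : Word → A} M → (∀ N → suc (length N) ≡ length M → f N ≋ g N) → alt f M ≋ alt g M
  alt-cong [] same = ≋-refl
  alt-cong (x ∷ M) same = ⊕-cong (same M P.refl) (⊖-cong (alt-cong M (λ N e → same (x ∷ N) (P.cong suc e))))

  alt-⊕ : ∀ (f g : Word → A) M → alt (λ N → f N ⊕ g N) M ≋ alt f M ⊕ alt g M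
  alt-⊕ f g [] = ≋-refl
  alt-⊕ f g (x ∷ M) = ≋-trans (⊕-cong ≋-refl (⊖-cong (alt-⊕ (λ N → f (x ∷ N)) (λ N → g (x ∷ N)) M)))
    (by-coefficients ((⌜ f M ⌝ ⊞ ⌜ g M ⌝) ⊞ (- 1#) ⊙ (⌜ F ⌝ ⊞ ⌜ G ⌝)) ((⌜ f M ⌝ ⊞ (- 1#) ⊙ ⌜ F ⌝) ⊞ (⌜ g M ⌝ ⊞ (- 1#) ⊙ ⌜ G ⌝))
      (λ w → solve 4 (λ a b x y → (a :+ b) :+ (:- :1) :* (x :+ y) := (a :+ (:- :1) :* x) :+ (b :+ (:- :1) :* y)) refl
               (coeff w (f M)) (coeff w (g M)) (coeff w F) (coeff w G)))
    where F = alt (λ N → f (x ∷ N)) M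
          G = alt (λ N → g (x ∷ N)) M

  alt-linear : ∀ {Φ} → Linear Φ → ∀ (f : Word → A) M → alt (λ N → Φ (f N)) M ≋ Φ (alt f M)
  alt-linear lΦ f [] = ≋-sym (Linear.0-hom lΦ)
  alt-linear lΦ f (x ∷ M) = ≋-trans (⊕-cong ≋-refl (⊖-cong (alt-linear lΦ (λ N → f (x ∷ N)) M)))
    (≋-trans (⊕-cong ≋-refl (≋-sym (Linear.sc-hom lΦ (- 1#) _))) (≋-sym (Linear.⊕-hom lΦ _ _)))

module TMinus {c ℓ : Level} (Rg : CommutativeRing c ℓ) (k : ℕ) (q : CommutativeRing.Carrier Rg) where
  open import Data.Nat as ℕ using (ℕ; zero; suc; _∸_; _/_)
  import Data.Nat.Properties as ℕP
  import Data.Nat.DivMod as ℕDM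
  open import Data.Bool using (Bool; true; false; if_then_else_)
  open import Data.Vec using (Vec; []; _∷_)
  open import Data.List using (List; []; _∷_; _++_; length; concatMap)
  import Data.List.Properties as ListP
  open import Data.Product using (_×_; _,_; proj₁; proj₂)
  open import Relation.Binary.PropositionalEquality as P using (_≡_)

  open CommutativeRing Rg
  open FreeAlgebra Rg k
  open CoefficientAlgebra Rg k
  open IntegerSolver Rg using (solve; _:=_; _:+_; _:*_; :-_; :0; :1)
  open import Algebra.Properties.Ring ring using (-1*x≈-x; -‿involutive)

  -- T⁻ M and T⁺ M: the sums over subsets I of positions of M of odd, resp.
  -- even, size of (-1)^ℓ_M(I) (-q)^⌊#I/2⌋ t_{M∖I}, defined by splitting on
  -- whether the first position lies in I.
  mutual
    T⁻ : Word → A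
    T⁻ [] = 0A
    T⁻ (x ∷ M) = T⁺ M ⊕ (⊖ lmul x (T⁻ M))

    T⁺ : Word → A
    T⁺ [] = mon []
    T⁺ (x ∷ M) = lmul x (T⁺ M) ⊕ sc (- q) (T⁻ M)

  ellSum-shift : ∀ {m} ν off (v : Vec Bool m) → ellSum (suc ν) (positions (suc off) v) ≡ ellSum ν (positions off v)
  ellSum-shift ν off [] = P.refl
  ellSum-shift ν off (true ∷ v) = P.cong ((suc off ∸ ν) ℕ.+_) (ellSum-shift (suc ν) (suc off) v)
  ellSum-shift ν off (false ∷ v) = ellSum-shift ν (suc off) v

  ellSum-skip : ∀ {m} ν off (v : Vec Bool m) → ν ℕ.≤ suc off →
    ellSum ν (positions (suc off) v) ≡ card v ℕ.+ ellSum ν (positions off v)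
  ellSum-skip ν off [] le = P.refl
  ellSum-skip ν off (true ∷ v) le =
    P.trans (P.cong₂ ℕ._+_ (ℕP.+-∸-assoc 1 le) (ellSum-skip (suc ν) (suc off) v (ℕ.s≤s le)))
            (P.cong suc (x∙yz≈y∙xz (suc off ∸ ν) (card v) _))
    where open import Algebra.Properties.CommutativeSemigroup ℕP.+-commutativeSemigroup using (x∙yz≈y∙xz)
  ellSum-skip ν off (false ∷ v) le = ellSum-skip ν (suc off) v (ℕP.m≤n⇒m≤1+n le)

  ell-in : ∀ {m} (v : Vec Bool m) → ell (true ∷ v) ≡ ell v
  ell-in v = ellSum-shift 1 0 v

  ell-out : ∀ {m} (v : Vec Bool m) → ell (false ∷ v) ≡ card v ℕ.+ ell v
  ell-out v = ellSum-skip 1 0 v (ℕ.s≤s ℕ.z≤n)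

  sign-+ : ∀ m n → sign (m ℕ.+ n) ≈ sign m * sign n
  sign-+ zero n = sym (*-identityˡ _)
  sign-+ (suc m) n = trans (*-congˡ (sign-+ m n)) (sym (*-assoc _ _ _))

  mutual
    sign-odd : ∀ n → odd n ≡ true → sign n ≈ - 1#
    sign-odd (suc n) odd-n+1 with odd n in eq | odd-n+1
    ... | false | _ = trans (*-congˡ (sign-even n eq)) (*-identityʳ _)

    sign-even : ∀ n → odd n ≡ false → sign n ≈ 1#
    sign-even zero _ = refl
    sign-even (suc n) even-n+1 with odd n in eq | even-n+1
    ... | true | _ = trans (*-congˡ (sign-odd n eq)) (trans (-1*x≈-x _) (-‿involutive 1#))

  half-suc : ∀ n → odd n ≡ true → suc n / 2 ≡ suc ((n ∸ 1) / 2)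
  half-suc (suc n) _ = ℕDM.m/n≡1+[m∸n]/n {suc (suc n)} {2} (ℕ.s≤s (ℕ.s≤s ℕ.z≤n))

  oddTerm : ∀ {m} → Word → Vec Bool m → A
  oddTerm ms I = if odd (card I) then sc (sign (ell I) * pow (- q) ((card I ∸ 1) / 2)) (mon (remove I ms)) else 0A

  evenTerm : ∀ {m} → Word → Vec Bool m → A
  evenTerm ms I = if odd (card I) then 0A else sc (sign (ell I) * pow (- q) (card I / 2)) (mon (remove I ms))

  oddSum : Word → A
  oddSum ms = concatMap (oddTerm ms) (choices (length ms))

  evenSum : Word → A
  evenSum ms = concatMap (evenTerm ms) (choices (length ms))

  oddTerm-in : ∀ {m} x ms (v : Vec Bool m) → oddTerm (x ∷ ms) (true ∷ v) ≋ evenTerm ms v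
  oddTerm-in x ms v with odd (card v)
  ... | true = ≋-refl
  ... | false = ≡⇒≋ (P.cong (λ e → sc (sign e * pow (- q) (card v / 2)) (mon (remove v ms))) (ell-in v))

  oddTerm-out : ∀ {m} x ms (v : Vec Bool m) → oddTerm (x ∷ ms) (false ∷ v) ≋ (⊖ lmul x (oddTerm ms v))
  oddTerm-out x ms v with odd (card v) in odd-v
  ... | false = ≋-refl
  ... | true = ≋-trans (sc-cong coefficient ≋-refl)
      (by-coefficients ((- 1# * r) ⊙ ⌜ mon (x ∷ remove v ms) ⌝) ((- 1#) ⊙ left x (r ⊙ ⌜ mon (remove v ms) ⌝))
        (λ w → solve 2 (λ r t → ((:- :1) :* r) :* t := (:- :1) :* (r :* t)) refl r (coeff w (mon (x ∷ remove v ms)))))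
    where
    p = pow (- q) ((card v ∸ 1) / 2)
    r = sign (ell v) * p
    coefficient : sign (ell (false ∷ v)) * p ≈ - 1# * r
    coefficient = begin
      sign (ell (false ∷ v)) * p          ≡⟨ P.cong (λ e → sign e * p) (ell-out v) ⟩
      sign (card v ℕ.+ ell v) * p         ≈⟨ *-congʳ (sign-+ (card v) (ell v)) ⟩
      (sign (card v) * sign (ell v)) * p  ≈⟨ *-congʳ (*-congʳ (sign-odd (card v) odd-v)) ⟩
      (- 1# * sign (ell v)) * p           ≈⟨ *-assoc _ _ _ ⟩
      - 1# * r                            ∎
      where open import Relation.Binary.Reasoning.Setoid setoid

  evenTerm-in : ∀ {m} x ms (v : Vec Bool m) → evenTerm (x ∷ ms) (true ∷ v) ≋ sc (- q) (oddTerm ms v)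
  evenTerm-in x ms v with odd (card v) in odd-v
  ... | false = ≋-refl
  ... | true = ≋-trans
      (≡⇒≋ (P.cong₂ (λ e f → sc (sign e * pow (- q) f) (mon (remove v ms))) (ell-in v) (half-suc (card v) odd-v)))
      (by-coefficients ((sign (ell v) * (- q * p)) ⊙ ⌜ mon (remove v ms) ⌝) ((- q) ⊙ (sign (ell v) * p) ⊙ ⌜ mon (remove v ms) ⌝)
        (λ w → solve 4 (λ s q p t → (s :* ((:- q) :* p)) :* t := (:- q) :* ((s :* p) :* t)) refl
                 (sign (ell v)) q p (coeff w (mon (remove v ms)))))
    where p = pow (- q) ((card v ∸ 1) / 2)

  evenTerm-out : ∀ {m} x ms (v : Vec Bool m) → evenTerm (x ∷ ms) (false ∷ v) ≋ lmul x (evenTerm ms v)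
  evenTerm-out x ms v with odd (card v) in odd-v
  ... | true = ≋-refl
  ... | false = sc-cong coefficient ≋-refl
    where
    p = pow (- q) (card v / 2)
    coefficient : sign (ell (false ∷ v)) * p ≈ sign (ell v) * p
    coefficient = begin
      sign (ell (false ∷ v)) * p          ≡⟨ P.cong (λ e → sign e * p) (ell-out v) ⟩
      sign (card v ℕ.+ ell v) * p         ≈⟨ *-congʳ (sign-+ (card v) (ell v)) ⟩
      (sign (card v) * sign (ell v)) * p  ≈⟨ *-congʳ (*-congʳ (sign-even (card v) odd-v)) ⟩
      (1# * sign (ell v)) * p             ≈⟨ *-congʳ (*-identityˡ _) ⟩
      sign (ell v) * p                    ∎
      where open import Relation.Binary.Reasoning.Setoid setoid

  concatMap-≋ : ∀ {B : Set} {f g : B → A} (bs : List B) → (∀ b → f b ≋ g b) → concatMap f bs ≋ concatMap g bs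
  concatMap-≋ [] same = ≋-refl
  concatMap-≋ (b ∷ bs) same = ⊕-cong (same b) (concatMap-≋ bs same)

  sum-choices-suc : ∀ {m} (f : Vec Bool (suc m) → A) →
    concatMap f (choices (suc m)) ≋ concatMap (λ v → f (true ∷ v)) (choices m) ⊕ concatMap (λ v → f (false ∷ v)) (choices m)
  sum-choices-suc {m} f = split (choices m)
    where
    split : ∀ vs → concatMap f (concatMap (λ v → (true ∷ v) ∷ (false ∷ v) ∷ []) vs)
                   ≋ concatMap (λ v → f (true ∷ v)) vs ⊕ concatMap (λ v → f (false ∷ v)) vs
    split [] = ≋-refl
    split (v ∷ vs) = ≋-trans (⊕-cong (≋-refl {f (true ∷ v)}) (⊕-cong (≋-refl {f (false ∷ v)}) (split vs)))
      (by-coefficients (⌜ a ⌝ ⊞ (⌜ b ⌝ ⊞ (⌜ X ⌝ ⊞ ⌜ Y ⌝))) ((⌜ a ⌝ ⊞ ⌜ X ⌝) ⊞ (⌜ b ⌝ ⊞ ⌜ Y ⌝))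
        (λ w → solve 4 (λ a b x y → a :+ (b :+ (x :+ y)) := (a :+ x) :+ (b :+ y)) refl
                 (coeff w a) (coeff w b) (coeff w X) (coeff w Y)))
      where
      a = f (true ∷ v)
      b = f (false ∷ v)
      X = concatMap (λ v → f (true ∷ v)) vs
      Y = concatMap (λ v → f (false ∷ v)) vs

  sums-recursion : ∀ ms → oddSum ms ≋ T⁻ ms × evenSum ms ≋ T⁺ ms
  sums-recursion [] = ≋-refl , by-coefficients ((1# * 1#) ⊙ ⌜ mon [] ⌝ ⊞ ⌜ [] ⌝) ⌜ mon [] ⌝
    (λ w → solve 1 (λ t → (:1 :* :1) :* t :+ :0 := t) refl (coeff w (mon [])))
  sums-recursion (x ∷ ms) = odd-recursion , even-recursion
    where
    open ≋-Reasoning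
    IH = sums-recursion ms
    vs = choices (length ms)

    odd-recursion : oddSum (x ∷ ms) ≋ T⁻ (x ∷ ms)
    odd-recursion = begin
      oddSum (x ∷ ms)
        ≈⟨ sum-choices-suc {length ms} (oddTerm (x ∷ ms)) ⟩
      concatMap (λ v → oddTerm (x ∷ ms) (true ∷ v)) vs ⊕ concatMap (λ v → oddTerm (x ∷ ms) (false ∷ v)) vs
        ≈⟨ ⊕-cong (concatMap-≋ vs (oddTerm-in x ms)) (concatMap-≋ vs (oddTerm-out x ms)) ⟩
      evenSum ms ⊕ concatMap (λ v → ⊖ lmul x (oddTerm ms v)) vs
        ≡⟨ P.cong (evenSum ms ⊕_) (P.trans (P.sym (ListP.map-concatMap _ (λ v → lmul x (oddTerm ms v)) vs))
                                           (P.cong (⊖_) (P.sym (ListP.map-concatMap _ (oddTerm ms) vs)))) ⟩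
      evenSum ms ⊕ (⊖ lmul x (oddSum ms))
        ≈⟨ ⊕-cong (proj₂ IH) (⊖-cong (lmul-cong x (proj₁ IH))) ⟩
      T⁻ (x ∷ ms) ∎

    even-recursion : evenSum (x ∷ ms) ≋ T⁺ (x ∷ ms)
    even-recursion = begin
      evenSum (x ∷ ms)
        ≈⟨ sum-choices-suc {length ms} (evenTerm (x ∷ ms)) ⟩
      concatMap (λ v → evenTerm (x ∷ ms) (true ∷ v)) vs ⊕ concatMap (λ v → evenTerm (x ∷ ms) (false ∷ v)) vs
        ≈⟨ ⊕-cong (concatMap-≋ vs (evenTerm-in x ms)) (concatMap-≋ vs (evenTerm-out x ms)) ⟩
      concatMap (λ v → sc (- q) (oddTerm ms v)) vs ⊕ concatMap (λ v → lmul x (evenTerm ms v)) vs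
        ≡⟨ P.cong₂ _⊕_ (P.sym (ListP.map-concatMap _ (oddTerm ms) vs)) (P.sym (ListP.map-concatMap _ (evenTerm ms) vs)) ⟩
      sc (- q) (oddSum ms) ⊕ lmul x (evenSum ms)
        ≈⟨ ⊕-cong (sc-cong refl (proj₁ IH)) (lmul-cong x (proj₂ IH)) ⟩
      sc (- q) (T⁻ ms) ⊕ lmul x (T⁺ ms)
        ≈⟨ by-coefficients ((- q) ⊙ ⌜ T⁻ ms ⌝ ⊞ left x ⌜ T⁺ ms ⌝) (left x ⌜ T⁺ ms ⌝ ⊞ (- q) ⊙ ⌜ T⁻ ms ⌝)
             (λ w → solve 3 (λ q o xe → (:- q) :* o :+ xe := xe :+ (:- q) :* o) refl
                      q (coeff w (T⁻ ms)) (coeff w (lmul x (T⁺ ms)))) ⟩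
      T⁺ (x ∷ ms) ∎

  tminus-T⁻ : ∀ M → tminus q M ≋ T⁻ (elems M)
  tminus-T⁻ M = proj₁ (sums-recursion (elems M))

  mutual
    T⁻-snoc : ∀ y M → T⁻ (M ++ y ∷ []) ≋ rmul y (T⁻ M) ⊕ sc (sign (length M)) (T⁺ M)
    T⁻-snoc y [] = by-coefficients (⌜ mon [] ⌝ ⊞ (- 1#) ⊙ left y ⌜ [] ⌝) (right y ⌜ [] ⌝ ⊞ 1# ⊙ ⌜ mon [] ⌝)
      (λ w → solve 1 (λ e → e :+ (:- :1) :* :0 := :0 :+ :1 :* e) refl (coeff w (mon [])))
    T⁻-snoc y (x ∷ M) = ≋-trans (⊕-cong (T⁺-snoc y M) (⊖-cong (lmul-cong x (T⁻-snoc y M))))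
      (by-coefficients
        ((right y ⌜ E ⌝ ⊞ (q * σ) ⊙ ⌜ O ⌝) ⊞ (- 1#) ⊙ left x (right y ⌜ O ⌝ ⊞ σ ⊙ ⌜ E ⌝))
        (right y (⌜ E ⌝ ⊞ (- 1#) ⊙ left x ⌜ O ⌝) ⊞ (- 1# * σ) ⊙ (left x ⌜ E ⌝ ⊞ (- q) ⊙ ⌜ O ⌝))
        (λ w → solve 6 (λ yE q σ o xOy xE →
             (yE :+ (q :* σ) :* o) :+ (:- :1) :* (xOy :+ σ :* xE)
          := (yE :+ (:- :1) :* xOy) :+ ((:- :1) :* σ) :* (xE :+ (:- q) :* o)) refl
          (coeff w (rmul y E)) q σ (coeff w O) (coeff w (lmul x (rmul y O))) (coeff w (lmul x E))))
      where E = T⁺ M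
            O = T⁻ M
            σ = sign (length M)

    T⁺-snoc : ∀ y M → T⁺ (M ++ y ∷ []) ≋ rmul y (T⁺ M) ⊕ sc (q * sign (length M)) (T⁻ M)
    T⁺-snoc y [] = by-coefficients (left y ⌜ mon [] ⌝ ⊞ (- q) ⊙ ⌜ [] ⌝) (right y ⌜ mon [] ⌝ ⊞ (q * 1#) ⊙ ⌜ [] ⌝)
      (λ w → solve 2 (λ ye q → ye :+ (:- q) :* :0 := ye :+ (q :* :1) :* :0) refl (coeff w (lmul y (mon []))) q)
    T⁺-snoc y (x ∷ M) = ≋-trans (⊕-cong (lmul-cong x (T⁺-snoc y M)) (sc-cong refl (T⁻-snoc y M)))
      (by-coefficients
        (left x (right y ⌜ E ⌝ ⊞ (q * σ) ⊙ ⌜ O ⌝) ⊞ (- q) ⊙ (right y ⌜ O ⌝ ⊞ σ ⊙ ⌜ E ⌝))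
        (right y (left x ⌜ E ⌝ ⊞ (- q) ⊙ ⌜ O ⌝) ⊞ (q * (- 1# * σ)) ⊙ (⌜ E ⌝ ⊞ (- 1#) ⊙ left x ⌜ O ⌝))
        (λ w → solve 6 (λ xEy q σ xO Oy e →
             xEy :+ (q :* σ) :* xO :+ (:- q) :* (Oy :+ σ :* e)
          := (xEy :+ (:- q) :* Oy) :+ (q :* ((:- :1) :* σ)) :* (e :+ (:- :1) :* xO)) refl
          (coeff w (lmul x (rmul y E))) q σ (coeff w (lmul x O)) (coeff w (rmul y O)) (coeff w E)))
      where E = T⁺ M
            O = T⁻ M
            σ = sign (length M)

module DeletionSums {c ℓ : Level} (Rg : CommutativeRing c ℓ) (k : ℕ) (q : CommutativeRing.Carrier Rg) where
  open import Data.Nat as ℕ using (suc)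
  import Data.Nat.Properties as ℕP
  open import Data.List using ([]; _∷_; _++_; length)
  import Data.List.Properties as ListP
  open import Data.Product using (_×_; _,_; proj₁; proj₂)
  open import Data.Fin.Subset using (Subset; _-_; _∪_)
  open import Data.Fin using (Fin)
  open import Relation.Binary.PropositionalEquality as P using (_≡_)

  open CommutativeRing Rg hiding (_-_)
  open FreeAlgebra Rg k
  open CoefficientAlgebra Rg k
  open TMinus Rg k q
  open IntegerSolver Rg using (solve; _:=_; _:+_; _:*_; :-_; :0; :1)
  open import Algebra.Properties.Ring ring using (-1*x≈-x; -‿involutive)

  alt-T : ∀ M → alt T⁺ M ≋ T⁻ M × alt T⁻ M ≋ 0A
  alt-T [] = ≋-refl , ≋-refl
  alt-T (x ∷ M) = alt-T⁺ , alt-T⁻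
    where
    open ≋-Reasoning
    IH = alt-T M

    alt-T⁺ : alt T⁺ (x ∷ M) ≋ T⁻ (x ∷ M)
    alt-T⁺ = begin
      T⁺ M ⊕ (⊖ alt (λ N → lmul x (T⁺ N) ⊕ sc (- q) (T⁻ N)) M)
        ≈⟨ ⊕-cong (≋-refl {T⁺ M}) (⊖-cong (alt-⊕ (λ N → lmul x (T⁺ N)) (λ N → sc (- q) (T⁻ N)) M)) ⟩
      T⁺ M ⊕ (⊖ (alt (λ N → lmul x (T⁺ N)) M ⊕ alt (λ N → sc (- q) (T⁻ N)) M))
        ≈⟨ ⊕-cong (≋-refl {T⁺ M}) (⊖-cong (⊕-cong (alt-linear (linear-lmul x) T⁺ M) (alt-linear (linear-sc (- q)) T⁻ M))) ⟩
      T⁺ M ⊕ (⊖ (lmul x (alt T⁺ M) ⊕ sc (- q) (alt T⁻ M)))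
        ≈⟨ ⊕-cong (≋-refl {T⁺ M}) (⊖-cong (⊕-cong (lmul-cong x (proj₁ IH)) (sc-cong refl (proj₂ IH)))) ⟩
      T⁺ M ⊕ (⊖ (lmul x (T⁻ M) ⊕ sc (- q) 0A))
        ≡⟨ P.cong (λ z → T⁺ M ⊕ (⊖ z)) (ListP.++-identityʳ _) ⟩
      T⁻ (x ∷ M) ∎

    alt-T⁻ : alt T⁻ (x ∷ M) ≋ 0A
    alt-T⁻ = begin
      T⁻ M ⊕ (⊖ alt (λ N → T⁺ N ⊕ (⊖ lmul x (T⁻ N))) M)
        ≈⟨ ⊕-cong (≋-refl {T⁻ M}) (⊖-cong (alt-⊕ T⁺ (λ N → ⊖ lmul x (T⁻ N)) M)) ⟩
      T⁻ M ⊕ (⊖ (alt T⁺ M ⊕ alt (λ N → ⊖ lmul x (T⁻ N)) M))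
        ≈⟨ ⊕-cong (≋-refl {T⁻ M}) (⊖-cong (⊕-cong (proj₁ IH)
             (≋-trans (alt-linear (linear-∘ (linear-sc (- 1#)) (linear-lmul x)) T⁻ M) (⊖-cong (lmul-cong x (proj₂ IH)))))) ⟩
      T⁻ M ⊕ (⊖ (T⁻ M ⊕ 0A))
        ≈⟨ by-coefficients (⌜ T⁻ M ⌝ ⊞ (- 1#) ⊙ (⌜ T⁻ M ⌝ ⊞ ⌜ 0A ⌝)) ⌜ 0A ⌝
             (λ w → solve 1 (λ o → o :+ (:- :1) :* (o :+ :0) := :0) refl (coeff w (T⁻ M))) ⟩
      0A ∎

  alt-T⁺-snoc : ∀ y M → alt (λ N → T⁺ (N ++ y ∷ [])) M ≋ rmul y (T⁻ M)
  alt-T⁺-snoc y [] = ≋-refl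
  alt-T⁺-snoc y (x ∷ M) = begin
    alt (λ N → T⁺ (N ++ y ∷ [])) (x ∷ M)
      ≈⟨ alt-cong (x ∷ M) (λ N e → ≋-trans (T⁺-snoc y N) (≡⇒≋ (P.cong (λ n → rmul y (T⁺ N) ⊕ sc (q * sign n) (T⁻ N)) (ℕP.suc-injective e)))) ⟩
    alt (λ N → rmul y (T⁺ N) ⊕ sc (q * σ) (T⁻ N)) (x ∷ M)
      ≈⟨ alt-⊕ (λ N → rmul y (T⁺ N)) (λ N → sc (q * σ) (T⁻ N)) (x ∷ M) ⟩
    alt (λ N → rmul y (T⁺ N)) (x ∷ M) ⊕ alt (λ N → sc (q * σ) (T⁻ N)) (x ∷ M)
      ≈⟨ ⊕-cong (alt-linear (linear-rmul y) T⁺ (x ∷ M)) (alt-linear (linear-sc (q * σ)) T⁻ (x ∷ M)) ⟩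
    rmul y (alt T⁺ (x ∷ M)) ⊕ sc (q * σ) (alt T⁻ (x ∷ M))
      ≈⟨ ⊕-cong (rmul-cong y (proj₁ (alt-T (x ∷ M)))) (sc-cong refl (proj₂ (alt-T (x ∷ M)))) ⟩
    rmul y (T⁻ (x ∷ M)) ⊕ sc (q * σ) 0A
      ≡⟨ ListP.++-identityʳ _ ⟩
    rmul y (T⁻ (x ∷ M)) ∎
    where open ≋-Reasoning
          σ = sign (length M)

  alt-T⁻-snoc : ∀ y M → alt (λ N → T⁻ (N ++ y ∷ [])) M ≋ sc (- sign (length M)) (T⁻ M)
  alt-T⁻-snoc y [] = ≋-refl
  alt-T⁻-snoc y (x ∷ M) = begin
    alt (λ N → T⁻ (N ++ y ∷ [])) (x ∷ M)
      ≈⟨ alt-cong (x ∷ M) (λ N e → ≋-trans (T⁻-snoc y N) (≡⇒≋ (P.cong (λ n → rmul y (T⁻ N) ⊕ sc (sign n) (T⁺ N)) (ℕP.suc-injective e)))) ⟩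
    alt (λ N → rmul y (T⁻ N) ⊕ sc σ (T⁺ N)) (x ∷ M)
      ≈⟨ alt-⊕ (λ N → rmul y (T⁻ N)) (λ N → sc σ (T⁺ N)) (x ∷ M) ⟩
    alt (λ N → rmul y (T⁻ N)) (x ∷ M) ⊕ alt (λ N → sc σ (T⁺ N)) (x ∷ M)
      ≈⟨ ⊕-cong (alt-linear (linear-rmul y) T⁻ (x ∷ M)) (alt-linear (linear-sc σ) T⁺ (x ∷ M)) ⟩
    rmul y (alt T⁻ (x ∷ M)) ⊕ sc σ (alt T⁺ (x ∷ M))
      ≈⟨ ⊕-cong (rmul-cong y (proj₂ (alt-T (x ∷ M)))) (sc-cong refl (proj₁ (alt-T (x ∷ M)))) ⟩
    sc σ (T⁻ (x ∷ M))
      ≈⟨ sc-cong (sym (trans (-‿cong (-1*x≈-x σ)) (-‿involutive σ))) ≋-refl ⟩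
    sc (- sign (length (x ∷ M))) (T⁻ (x ∷ M)) ∎
    where open ≋-Reasoning
          σ = sign (length M)

  midSum-alt : ∀ (U : Subset k) (G : Word → A) i js →
    (∀ p j post → js ≡ p ++ j ∷ post → tminus q (U - j) ≋ G (p ++ post)) →
    midSum q U i js ≋ sc (sign i) (alt G js)
  midSum-alt U G i [] deletions = ≋-refl
  midSum-alt U G i (j ∷ js) deletions = ≋-trans
    (⊕-cong (sc-cong refl (deletions [] j js P.refl))
            (midSum-alt U (λ N → G (j ∷ N)) (suc i) js (λ p j′ post e → deletions (j ∷ p) j′ post (P.cong (j ∷_) e))))
    (by-coefficients (sign i ⊙ ⌜ X ⌝ ⊞ (- 1# * sign i) ⊙ ⌜ Y ⌝) (sign i ⊙ (⌜ X ⌝ ⊞ (- 1#) ⊙ ⌜ Y ⌝))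
      (λ w → solve 3 (λ s x y → s :* x :+ ((:- :1) :* s) :* y := s :* (x :+ (:- :1) :* y)) refl
               (sign i) (coeff w X) (coeff w Y)))
    where X = G js
          Y = alt (λ N → G (j ∷ N)) js

  deletion-sum : ∀ a b c m → let O = T⁻ m; σ = sign (length m) in
    alt (λ N → T⁻ (a ∷ b ∷ (N ++ c ∷ []))) m
      ≋ (lmul b (rmul c O) ⊕ (⊖ lmul a (rmul c O))) ⊕ (sc (- q) (sc (- σ) O) ⊕ lmul a (lmul b (sc (- σ) O)))
  deletion-sum a b c m = begin
    alt (λ N → T⁻ (a ∷ b ∷ (N ++ c ∷ []))) m
      ≈⟨ alt-cong m (λ N _ → expand (N ++ c ∷ [])) ⟩
    alt (λ N → Φ (T⁺ (N ++ c ∷ [])) ⊕ Ψ (T⁻ (N ++ c ∷ []))) m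
      ≈⟨ alt-⊕ (λ N → Φ (T⁺ (N ++ c ∷ []))) (λ N → Ψ (T⁻ (N ++ c ∷ []))) m ⟩
    alt (λ N → Φ (T⁺ (N ++ c ∷ []))) m ⊕ alt (λ N → Ψ (T⁻ (N ++ c ∷ []))) m
      ≈⟨ ⊕-cong (alt-linear linear-Φ (λ N → T⁺ (N ++ c ∷ [])) m) (alt-linear linear-Ψ (λ N → T⁻ (N ++ c ∷ [])) m) ⟩
    Φ (alt (λ N → T⁺ (N ++ c ∷ [])) m) ⊕ Ψ (alt (λ N → T⁻ (N ++ c ∷ [])) m)
      ≈⟨ ⊕-cong (Linear.cong linear-Φ (alt-T⁺-snoc c m)) (Linear.cong linear-Ψ (alt-T⁻-snoc c m)) ⟩
    Φ (rmul c (T⁻ m)) ⊕ Ψ (sc (- sign (length m)) (T⁻ m)) ∎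
    where
    open ≋-Reasoning
    -- T⁻ (a b X) = Φ (T⁺ X) + Ψ (T⁻ X), by the first-letter recursion twice.
    Φ Ψ : A → A
    Φ e = lmul b e ⊕ (⊖ lmul a e)
    Ψ o = sc (- q) o ⊕ lmul a (lmul b o)

    linear-Φ : Linear Φ
    linear-Φ = linear-⊕ (linear-lmul b) (linear-∘ (linear-sc (- 1#)) (linear-lmul a))

    linear-Ψ : Linear Ψ
    linear-Ψ = linear-⊕ (linear-sc (- q)) (linear-∘ (linear-lmul a) (linear-lmul b))

    expand : ∀ X → T⁻ (a ∷ b ∷ X) ≋ Φ (T⁺ X) ⊕ Ψ (T⁻ X)
    expand X = by-coefficients
      ((left b ⌜ E ⌝ ⊞ (- q) ⊙ ⌜ O ⌝) ⊞ (- 1#) ⊙ left a (⌜ E ⌝ ⊞ (- 1#) ⊙ left b ⌜ O ⌝))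
      ((left b ⌜ E ⌝ ⊞ (- 1#) ⊙ left a ⌜ E ⌝) ⊞ ((- q) ⊙ ⌜ O ⌝ ⊞ left a (left b ⌜ O ⌝)))
      (λ w → solve 5 (λ q bE o aE abO →
           (bE :+ (:- q) :* o) :+ (:- :1) :* (aE :+ (:- :1) :* abO)
        := (bE :+ (:- :1) :* aE) :+ ((:- q) :* o :+ abO)) refl
        q (coeff w (lmul b E)) (coeff w O) (coeff w (lmul a E)) (coeff w (lmul a (lmul b O))))
      where E = T⁺ X
            O = T⁻ X

  deletion-identity : ∀ (J L : Subset k) (a b c : Fin k) (m : Word) →
    elems J ≡ a ∷ (m ++ c ∷ []) → elems L ≡ b ∷ m →
    (∀ p j post → m ≡ p ++ j ∷ post → elems ((J ∪ L) - j) ≡ a ∷ b ∷ ((p ++ post) ++ c ∷ [])) →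
    (((tminus q J ⊕ (⊖ (tminus q L ⊗ gen c))) ⊕ (⊖ midSum q (J ∪ L) 2 m))
       ⊕ sc (sign (2 ℕ.+ length m)) (gen a ⊗ tminus q L)) ≋ 0A
  deletion-identity J L a b c m eJ eL deletions = ≋-trans
    (⊕-cong (⊕-cong (⊕-cong tJ (⊖-cong (≋-trans (⊗-gen c (tminus q L)) (rmul-cong c tL))))
                    (⊖-cong (≋-trans (midSum-alt (J ∪ L) (λ N → T⁻ (a ∷ b ∷ (N ++ c ∷ []))) 2 m tDeleted)
                                     (sc-cong refl (deletion-sum a b c m)))))
            (sc-cong refl (≋-trans (gen-⊗ a (tminus q L)) (lmul-cong a tL))))
    (by-coefficients
      (right c ⌜ E ⌝ ⊞ (q * σ) ⊙ ⌜ O ⌝ ⊞ (- 1#) ⊙ left a (right c ⌜ O ⌝ ⊞ σ ⊙ ⌜ E ⌝)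
        ⊞ (- 1#) ⊙ right c (⌜ E ⌝ ⊞ (- 1#) ⊙ left b ⌜ O ⌝)
        ⊞ (- 1#) ⊙ sign 2 ⊙ (left b (right c ⌜ O ⌝) ⊞ (- 1#) ⊙ left a (right c ⌜ O ⌝)
                              ⊞ ((- q) ⊙ (- σ) ⊙ ⌜ O ⌝ ⊞ left a (left b ((- σ) ⊙ ⌜ O ⌝))))
        ⊞ sign (2 ℕ.+ length m) ⊙ left a (⌜ E ⌝ ⊞ (- 1#) ⊙ left b ⌜ O ⌝))
      ⌜ 0A ⌝
      (λ w → solve 8 (λ q σ Ec o aOc aE bOc abO →
             Ec :+ (q :* σ) :* o :+ (:- :1) :* (aOc :+ σ :* aE)
          :+ (:- :1) :* (Ec :+ (:- :1) :* bOc)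
          :+ (:- :1) :* (((:- :1) :* ((:- :1) :* :1))
                           :* (bOc :+ (:- :1) :* aOc :+ ((:- q) :* ((:- σ) :* o) :+ (:- σ) :* abO)))
          :+ ((:- :1) :* ((:- :1) :* σ)) :* (aE :+ (:- :1) :* abO)
        := :0) refl
        q σ (coeff w (rmul c E)) (coeff w O) (coeff w (lmul a (rmul c O))) (coeff w (lmul a E))
        (coeff w (lmul b (rmul c O))) (coeff w (lmul a (lmul b O)))))
    where
    E = T⁺ m
    O = T⁻ m
    σ = sign (length m)

    tJ : tminus q J ≋ (rmul c E ⊕ sc (q * σ) O) ⊕ (⊖ lmul a (rmul c O ⊕ sc σ E))
    tJ = ≋-trans (≋-trans (tminus-T⁻ J) (≡⇒≋ (P.cong T⁻ eJ)))
                 (⊕-cong (T⁺-snoc c m) (⊖-cong (lmul-cong a (T⁻-snoc c m))))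

    tL : tminus q L ≋ T⁻ (b ∷ m)
    tL = ≋-trans (tminus-T⁻ L) (≡⇒≋ (P.cong T⁻ eL))

    tDeleted : ∀ p j post → m ≡ p ++ j ∷ post → tminus q ((J ∪ L) - j) ≋ T⁻ (a ∷ b ∷ ((p ++ post) ++ c ∷ []))
    tDeleted p j post e = ≋-trans (tminus-T⁻ ((J ∪ L) - j)) (≡⇒≋ (P.cong T⁻ (deletions p j post e)))

-- The vocabulary of the statement (opened only here, since it would clash
-- with the ring operations used above).
open import Data.Nat using (ℕ; _+_; suc)
open import Data.Fin using (Fin; _<_)
open import Data.Fin.Subset using (Subset; _∪_; _-_)
open import Data.List using (List; _∷_; []; _++_; length)
open import Relation.Binary.PropositionalEquality using (_≡_)
open FreeAlgebra using (tminus; _⊕_; ⊖_; _⊗_; gen; midSum; sc; sign; _≈A_; 0A)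
import Relation.Binary.PropositionalEquality as P

lemma3p3 : {c ℓ : Level} (Rg : CommutativeRing c ℓ) (k : ℕ)
  (q : CommutativeRing.Carrier Rg) (J L : Subset k)
  (j₁ jₙ l₁ : Fin k) (mid ls : List (Fin k))
  → elems J ≡ j₁ ∷ (mid ++ (jₙ ∷ []))
  → elems L ≡ l₁ ∷ ls
  → (J - j₁) - jₙ ≡ L - l₁
  → j₁ < l₁
  → _≈A_ Rg k
      (_⊕_ Rg k
        (_⊕_ Rg k
          (_⊕_ Rg k (tminus Rg k q J) (⊖_ Rg k (_⊗_ Rg k (tminus Rg k q L) (gen Rg k jₙ))))
          (⊖_ Rg k (midSum Rg k q (J ∪ L) 2 mid)))
        (sc Rg k (sign Rg k (2 + length mid)) (_⊗_ Rg k (gen Rg k j₁) (tminus Rg k q L))))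
      (0A Rg k)
lemma3p3 Rg k q J L j₁ jₙ l₁ mid ls eJ eL eS j₁<l₁ =
  coeff-≈ (deletion-identity J L j₁ l₁ jₙ mid eJ eL′ (delete-middle J L j₁ l₁ jₙ mid eJ eL′ j₁<l₁))
  where
  open SortedSubsets using (shared-middle; delete-middle)
  open CoefficientAlgebra Rg k using (coeff-≈)
  open DeletionSums Rg k q using (deletion-identity)

  eL′ : elems L ≡ l₁ ∷ mid
  eL′ = P.trans eL (P.cong (l₁ ∷_) (shared-middle J L j₁ l₁ jₙ mid ls eJ eL eS))
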